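{- The determinant of an $n\times n$ weighted threshold graph matrix $M_{b_1 \dots b_{n-1}}^{d_1 \dots d_n}$ (given by the entries $b_1,\dots,b_{n-1},d_1,\dots,d_n$) can be computed using $O(n)$ arithmetic operations.
   Context: For elements $b_1,\dots,b_{n-1}$, $d_1,\dots,d_n$ of a field (or commutative ring), the weighted threshold graph matrix $M_{b_1 \dots b_{n-1}}^{d_1 \dots d_n}$ is the $n\times n$ matrix with $(i,j)$ entry $b_i$ if $i<j$, $b_j$ if $j<i$, and $d_i$ if $i=j$. Complexity is measured in the algebraic model: each arithmetic operation (addition, subtraction, multiplication) counts as one step. -}

module Defs where

open import Level using (Level)
open import Data.Nat as ℕ using (ℕ; zero; suc)
open import Data.Nat.Properties as ℕP using (<-≤-trans)
open import Data.Fin using (Fin; zero; suc; toℕ; fromℕ<; punchIn; _<_)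
open import Data.Fin.Properties using (<-cmp; toℕ≤pred[n])
open import Data.Vec.Functional using (Vector; _∷_; _++_)
open import Relation.Binary.Definitions using (tri<; tri≈; tri>)
open import Algebra.Bundles using (CommutativeRing)

-- Algebraic model of computation: division-free straight-line programs.  Each instruction applies one of
-- +, -, * to two existing registers and pushes the result as a new
-- register (at index zero; older registers shift by one).

data Instr (k : ℕ) : Set where
  add sub mul : Fin k → Fin k → Instr k

data SLP (k : ℕ) : Set where
  ret : Fin k → SLP k
  _▹_ : Instr k → SLP (suc k) → SLP k

size : ∀ {k} → SLP k → ℕ
size (ret _) = 0
size (_ ▹ p) = suc (size p)

module _ {c ℓ : Level} (R : CommutativeRing c ℓ) where
  open CommutativeRing R using (Carrier; _+_; _-_; _*_; -_; 0#; 1#)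

  evalInstr : ∀ {k} → Instr k → Vector Carrier k → Carrier
  evalInstr (add i j) env = env i + env j
  evalInstr (sub i j) env = env i - env j
  evalInstr (mul i j) env = env i * env j

  eval : ∀ {k} → SLP k → Vector Carrier k → Carrier
  eval (ret r) env = env r
  eval (ι ▹ p) env = eval p (evalInstr ι env ∷ env)

  sumFin : ∀ {n} → (Fin n → Carrier) → Carrier
  sumFin {zero}  f = 0#
  sumFin {suc n} f = f zero + sumFin (λ i → f (suc i))

  sign : ∀ {n} → Fin n → Carrier
  sign zero    = 1#
  sign (suc j) = - sign j

  det : ∀ n → (Fin n → Fin n → Carrier) → Carrier
  det zero    M = 1#
  det (suc n) M =
    sumFin (λ j → sign j * (M zero j * det n (λ i k → M (suc i) (punchIn j k))))

  -- Weighted threshold graph matrix M_{b_1..b_{n-1}}^{d_1..d_n}, n = suc m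
  -- (0-indexed): entry (i,j) is b_i if i<j, b_j if j<i, d_i if i=j.

  threshold : ∀ m → (Fin m → Carrier) → (Fin (suc m) → Carrier)
            → Fin (suc m) → Fin (suc m) → Carrier
  threshold m b d i j with <-cmp i j
  ... | tri< i<j _ _ = b (fromℕ< (<-≤-trans i<j (toℕ≤pred[n] j)))
  ... | tri≈ _ _ _   = d i
  ... | tri> _ _ j<i = b (fromℕ< (<-≤-trans j<i (toℕ≤pred[n] i)))

-- Input registers of a program for the n×n determinant (n = suc m):
-- register 0 holds the constant 1, followed by b_1..b_{m}, d_1..d_{m+1}.
InputRegs : ℕ → ℕ
InputRegs m = suc (m ℕ.+ suc m)

inputs : ∀ {c ℓ} (R : CommutativeRing c ℓ) m
       → (Fin m → CommutativeRing.Carrier R)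
       → (Fin (suc m) → CommutativeRing.Carrier R)
       → Vector (CommutativeRing.Carrier R) (InputRegs m)
inputs R m b d = CommutativeRing.1# R ∷ (b ++ d)

module Submission where

-- Peeling off the first row and column, T_{m+1}(b, d) has first row
-- (d₀, b₀, …, b₀) and T_m(b', d') (the tails) in the lower right corner.
-- Writing the first row as (d₀ - b₀) e₀ + b₀ 1 gives
--   det T_{m+1} = (d₀ - b₀) det T_m + b₀ Q_m(b₀),
-- where Q_m(γ) = det [[1, 1ᵀ], [γ 1, T_m]] is a bordered determinant, and
-- a row swap, a row operation and expansion along a sparse row give
--   Q_{m+1}(γ) = (d₀ - b₀) Q_m(γ) - (γ - b₀) Q_m(b₀).
-- Since Q_m is affine in γ, say Q_m(γ) = p - γ r, the triple (det T_m, p, r)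
-- obeys a recurrence costing 10 operations per step; for m = 0 it is
-- (d₀, d₀, 1), read off the inputs without any operation.

open import Level using (Level; _⊔_)
open import Algebra.Bundles using (CommutativeRing)
open import Data.Nat as ℕ using (ℕ; zero; suc)
import Data.Nat.Properties as ℕₚ
open import Data.Fin as Fin using (Fin; zero; suc; punchIn; toℕ; _↑ˡ_; _↑ʳ_; #_)
open import Data.Product using (Σ; _×_; _,_; proj₁; proj₂)
open import Data.Vec.Functional using (Vector; _∷_; head; tail)
open import Data.Vec.Functional.Properties using (lookup-++ˡ; lookup-++ʳ)
open import Function using (id; _∘_)
open import Relation.Binary.PropositionalEquality as ≡ using (_≡_)
open import Defs

-- A ring solver for an arbitrary commutative ring R with integer
-- coefficients: the solver of Algebra.Solver.Ring, instantiated along the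
-- canonical ring homomorphism ℤ → R, i ↦ i · 1.  It proves the routine
-- polynomial rearrangements below, including those relying on cancellation.
module IntegerSolver {c ℓ : Level} (R : CommutativeRing c ℓ) where
  open import Algebra.Bundles using (RawRing)
  open import Algebra.Solver.Ring.AlmostCommutativeRing
    using (fromCommutativeRing; _-Raw-AlmostCommutative⟶_)
  open import Data.Maybe using (Maybe; just; nothing)
  open import Data.Integer as ℤ using (ℤ; +_; -[1+_]; _⊖_)
  import Data.Integer.Properties as ℤₚ
  open import Data.Sign as Sign using (Sign)
  open import Relation.Nullary using (yes; no)

  open CommutativeRing R
  open import Algebra.Properties.Ring ring
    using (-‿distribˡ-*; -‿distribʳ-*; -‿involutive; -0#≈0#; -‿+-comm)
  open import Algebra.Properties.Semiring.Mult.TCOptimised semiring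
    using (×-homo-+; ×1-homo-*; 1+×) renaming (_×_ to _·_)
  open import Relation.Binary.Reasoning.Setoid setoid

  ℤ-rawRing : RawRing _ _
  ℤ-rawRing = record
    { Carrier = ℤ ; _≈_ = _≡_ ; _+_ = ℤ._+_ ; _*_ = ℤ._*_ ; -_ = ℤ.-_
    ; 0# = ℤ.0ℤ ; 1# = ℤ.1ℤ }

  ⟦_⟧ : ℤ → Carrier
  ⟦ + n ⟧      = n · 1#
  ⟦ -[1+ n ] ⟧ = - (ℕ.suc n · 1#)

  signed : Sign → Carrier → Carrier
  signed Sign.+ x = x
  signed Sign.- x = - x

  signed-cong : ∀ s {x y} → x ≈ y → signed s x ≈ signed s y
  signed-cong Sign.+ x≈y = x≈y
  signed-cong Sign.- x≈y = -‿cong x≈y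

  signed-* : ∀ s t x y → signed (s Sign.* t) (x * y) ≈ signed s x * signed t y
  signed-* Sign.+ Sign.+ x y = refl
  signed-* Sign.+ Sign.- x y = -‿distribʳ-* x y
  signed-* Sign.- Sign.+ x y = -‿distribˡ-* x y
  signed-* Sign.- Sign.- x y = begin
    x * y           ≈⟨ -‿involutive (x * y) ⟨
    - (- (x * y))   ≈⟨ -‿cong (-‿distribˡ-* x y) ⟩
    - (- x * y)     ≈⟨ -‿distribʳ-* (- x) y ⟩
    - x * - y       ∎

  ⟦⟧-signed : ∀ i → ⟦ i ⟧ ≈ signed (ℤ.sign i) (ℤ.∣ i ∣ · 1#)
  ⟦⟧-signed (+ n)      = refl
  ⟦⟧-signed -[1+ n ]   = refl

  ⟦◃⟧ : ∀ s n → ⟦ s ℤ.◃ n ⟧ ≈ signed s (n · 1#)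
  ⟦◃⟧ Sign.+ ℕ.zero    = refl
  ⟦◃⟧ Sign.- ℕ.zero    = sym -0#≈0#
  ⟦◃⟧ Sign.+ (ℕ.suc n) = refl
  ⟦◃⟧ Sign.- (ℕ.suc n) = refl

  ⟦⊖⟧ : ∀ m n → ⟦ m ⊖ n ⟧ ≈ m · 1# - n · 1#
  ⟦⊖⟧ m ℕ.zero = begin
    ⟦ m ⊖ 0 ⟧       ≡⟨ ≡.cong ⟦_⟧ (ℤₚ.⊖-≥ {m} ℕ.z≤n) ⟩
    m · 1#          ≈⟨ +-identityʳ _ ⟨
    m · 1# + 0#     ≈⟨ +-congˡ -0#≈0# ⟨
    m · 1# - 0#     ∎
  ⟦⊖⟧ ℕ.zero (ℕ.suc n) = begin
    ⟦ 0 ⊖ ℕ.suc n ⟧              ≡⟨ ≡.cong ⟦_⟧ (ℤₚ.⊖-< {0} {ℕ.suc n} (ℕ.s≤s ℕ.z≤n)) ⟩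
    - (ℕ.suc n · 1#)             ≈⟨ +-identityˡ _ ⟨
    0# - ℕ.suc n · 1#            ∎
  ⟦⊖⟧ (ℕ.suc m) (ℕ.suc n) = begin
    ⟦ ℕ.suc m ⊖ ℕ.suc n ⟧        ≡⟨ ≡.cong ⟦_⟧ (ℤₚ.[1+m]⊖[1+n]≡m⊖n m n) ⟩
    ⟦ m ⊖ n ⟧                    ≈⟨ ⟦⊖⟧ m n ⟩
    x + - y                      ≈⟨ +-congˡ (+-identityˡ _) ⟨
    x + (0# + - y)               ≈⟨ +-congˡ (+-congʳ (-‿inverseʳ 1#)) ⟨
    x + ((1# - 1#) + - y)        ≈⟨ +-congˡ (+-assoc 1# (- 1#) (- y)) ⟩
    x + (1# + (- 1# + - y))      ≈⟨ +-assoc x 1# _ ⟨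
    (x + 1#) + (- 1# + - y)      ≈⟨ +-cong (+-comm x 1#) (-‿+-comm 1# y) ⟩
    (1# + x) - (1# + y)          ≈⟨ +-cong (1+× m 1#) (-‿cong (1+× n 1#)) ⟨
    ℕ.suc m · 1# - ℕ.suc n · 1#  ∎
    where
    x = m · 1#
    y = n · 1#

  +-homo : ∀ i j → ⟦ i ℤ.+ j ⟧ ≈ ⟦ i ⟧ + ⟦ j ⟧
  +-homo (+ m)    (+ n)    = ×-homo-+ 1# m n
  +-homo (+ m)    -[1+ n ] = ⟦⊖⟧ m (ℕ.suc n)
  +-homo -[1+ m ] (+ n)    = trans (⟦⊖⟧ n (ℕ.suc m)) (+-comm _ _)
  +-homo -[1+ m ] -[1+ n ] = begin
    - (ℕ.suc (ℕ.suc m ℕ.+ n) · 1#)          ≡⟨ ≡.cong (λ k → - (k · 1#)) (ℕₚ.+-suc (ℕ.suc m) n) ⟨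
    - ((ℕ.suc m ℕ.+ ℕ.suc n) · 1#)          ≈⟨ -‿cong (×-homo-+ 1# (ℕ.suc m) (ℕ.suc n)) ⟩
    - (ℕ.suc m · 1# + ℕ.suc n · 1#)         ≈⟨ -‿+-comm _ _ ⟨
    - (ℕ.suc m · 1#) + - (ℕ.suc n · 1#)     ∎

  *-homo : ∀ i j → ⟦ i ℤ.* j ⟧ ≈ ⟦ i ⟧ * ⟦ j ⟧
  *-homo i j = begin
    ⟦ s ℤ.◃ ℤ.∣ i ∣ ℕ.* ℤ.∣ j ∣ ⟧                         ≈⟨ ⟦◃⟧ s (ℤ.∣ i ∣ ℕ.* ℤ.∣ j ∣) ⟩
    signed s ((ℤ.∣ i ∣ ℕ.* ℤ.∣ j ∣) · 1#)                 ≈⟨ signed-cong s (×1-homo-* ℤ.∣ i ∣ ℤ.∣ j ∣) ⟩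
    signed s ((ℤ.∣ i ∣ · 1#) * (ℤ.∣ j ∣ · 1#))             ≈⟨ signed-* (ℤ.sign i) (ℤ.sign j) _ _ ⟩
    signed (ℤ.sign i) (ℤ.∣ i ∣ · 1#) * signed (ℤ.sign j) (ℤ.∣ j ∣ · 1#)
                                                          ≈⟨ *-cong (⟦⟧-signed i) (⟦⟧-signed j) ⟨
    ⟦ i ⟧ * ⟦ j ⟧                                          ∎
    where s = ℤ.sign i Sign.* ℤ.sign j

  -‿homo : ∀ i → ⟦ ℤ.- i ⟧ ≈ - ⟦ i ⟧
  -‿homo (+ ℕ.zero)  = sym -0#≈0#
  -‿homo (+ ℕ.suc n) = refl
  -‿homo -[1+ n ]    = sym (-‿involutive _)

  ℤ⟶R : ℤ-rawRing -Raw-AlmostCommutative⟶ fromCommutativeRing R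
  ℤ⟶R = record
    { ⟦_⟧ = ⟦_⟧ ; +-homo = +-homo ; *-homo = *-homo ; -‿homo = -‿homo
    ; 0-homo = refl ; 1-homo = refl }

  -- the solver only needs to recognise equal coefficients
  coefficients? : ∀ i j → Maybe (⟦ i ⟧ ≈ ⟦ j ⟧)
  coefficients? i j with i ℤ.≟ j
  ... | yes ≡.refl = just refl
  ... | no _       = nothing

  open import Algebra.Solver.Ring ℤ-rawRing (fromCommutativeRing R) ℤ⟶R coefficients? public
    using (solve; _:=_; _:+_; _:*_; _:-_; :-_; con; Polynomial)

  𝟘 𝟙 : ∀ {n} → Polynomial n
  𝟘 = con ℤ.0ℤ
  𝟙 = con ℤ.1ℤ

module DeterminantAlgebra {c ℓ : Level} (R : CommutativeRing c ℓ) where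
  open CommutativeRing R hiding (zero)
  open import Algebra.Properties.Ring ring using (+-inverseʳ-unique)
  open IntegerSolver R
  open import Relation.Binary.Reasoning.Setoid setoid

  Row : ℕ → Set c
  Row n = Fin n → Carrier

  Rows : ℕ → ℕ → Set c
  Rows m n = Fin m → Row n

  ∑ : ∀ {n} → Row n → Carrier
  ∑ = sumFin R

  sgn : ∀ {n} → Fin n → Carrier
  sgn = sign R

  dropColumn : ∀ {m n} → Fin (suc n) → Rows m (suc n) → Rows m n
  dropColumn j Rs i k = Rs i (punchIn j k)

  ∑-cong : ∀ {n} {f g : Row n} → (∀ j → f j ≈ g j) → ∑ f ≈ ∑ g
  ∑-cong {zero}  f≈g = refl
  ∑-cong {suc n} f≈g = +-cong (f≈g zero) (∑-cong (f≈g ∘ suc))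

  ∑-zero : ∀ {n} {f : Row n} → (∀ j → f j ≈ 0#) → ∑ f ≈ 0#
  ∑-zero {zero}  f≈0 = refl
  ∑-zero {suc n} f≈0 = trans (+-cong (f≈0 zero) (∑-zero (f≈0 ∘ suc))) (+-identityʳ 0#)

  ∑-linear : ∀ {n} α β {f g h : Row n} → (∀ j → f j ≈ α * g j + β * h j) →
             ∑ f ≈ α * ∑ g + β * ∑ h
  ∑-linear {zero} α β _ = solve 2 (λ α β → 𝟘 := α :* 𝟘 :+ β :* 𝟘) refl α β
  ∑-linear {suc n} α β {f} {g} {h} f≈ = begin
    f zero + ∑ (f ∘ suc)
      ≈⟨ +-cong (f≈ zero) (∑-linear α β (f≈ ∘ suc)) ⟩
    (α * g zero + β * h zero) + (α * ∑ (g ∘ suc) + β * ∑ (h ∘ suc))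
      ≈⟨ solve 6 (λ α β a b c d → (α :* a :+ β :* b) :+ (α :* c :+ β :* d)
                                  := α :* (a :+ c) :+ β :* (b :+ d))
               refl α β (g zero) (h zero) _ _ ⟩
    α * (g zero + ∑ (g ∘ suc)) + β * (h zero + ∑ (h ∘ suc)) ∎

  det-cong : ∀ n (M N : Rows n n) → (∀ i j → M i j ≈ N i j) → det R n M ≈ det R n N
  det-cong zero    M N M≈N = refl
  det-cong (suc n) M N M≈N = ∑-cong {f = term M} {g = term N} λ j →
    *-congˡ (*-cong (M≈N zero j) (det-cong n _ _ λ i k → M≈N (suc i) (punchIn j k)))
    where
    term : Rows (suc n) (suc n) → Row (suc n)
    term M j = sgn j * (M zero j * det R n (dropColumn j (M ∘ suc)))

  det-linear₀ : ∀ {n} α β {x y z : Row (suc n)} (Rs : Rows n (suc n)) →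
                (∀ j → x j ≈ α * y j + β * z j) →
                det R (suc n) (x ∷ Rs) ≈ α * det R (suc n) (y ∷ Rs) + β * det R (suc n) (z ∷ Rs)
  det-linear₀ {n} α β {x} {y} {z} Rs x≈ = ∑-linear α β λ j → begin
    sgn j * (x j * m j)                           ≈⟨ *-congˡ (*-congʳ (x≈ j)) ⟩
    sgn j * ((α * y j + β * z j) * m j)
      ≈⟨ solve 6 (λ α β s y z m → s :* ((α :* y :+ β :* z) :* m)
                                  := α :* (s :* (y :* m)) :+ β :* (s :* (z :* m)))
               refl α β (sgn j) (y j) (z j) (m j) ⟩
    α * (sgn j * (y j * m j)) + β * (sgn j * (z j * m j)) ∎
    where
    m : Fin (suc n) → Carrier
    m j = det R n (dropColumn j Rs)

  det-dropColumn-∷ : ∀ {n} j (y : Row (suc (suc n))) (Rs : Rows n (suc (suc n))) →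
    det R (suc n) (dropColumn j (y ∷ Rs)) ≈ det R (suc n) ((y ∘ punchIn j) ∷ dropColumn j Rs)
  det-dropColumn-∷ {n} j y Rs =
    det-cong (suc n) (dropColumn j (y ∷ Rs)) ((y ∘ punchIn j) ∷ dropColumn j Rs) λ { zero k → refl ; (suc i) k → refl }

  -- linearity in the second row, from linearity of every minor in its first row
  det-linear₁ : ∀ {n} α β (x : Row (suc (suc n))) {y y₁ y₂ : Row (suc (suc n))}
                (Rs : Rows n (suc (suc n))) → (∀ j → y j ≈ α * y₁ j + β * y₂ j) →
                det R (suc (suc n)) (x ∷ y ∷ Rs) ≈
                α * det R (suc (suc n)) (x ∷ y₁ ∷ Rs) + β * det R (suc (suc n)) (x ∷ y₂ ∷ Rs)
  det-linear₁ {n} α β x {y} {y₁} {y₂} Rs y≈ = ∑-linear α β λ j → begin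
    sgn j * (x j * minor y j)
      ≈⟨ *-congˡ (*-congˡ (minor-linear j)) ⟩
    sgn j * (x j * (α * minor y₁ j + β * minor y₂ j))
      ≈⟨ solve 6 (λ α β s x a b → s :* (x :* (α :* a :+ β :* b))
                                  := α :* (s :* (x :* a)) :+ β :* (s :* (x :* b)))
               refl α β (sgn j) (x j) (minor y₁ j) (minor y₂ j) ⟩
    α * (sgn j * (x j * minor y₁ j)) + β * (sgn j * (x j * minor y₂ j)) ∎
    where
    minor : Row (suc (suc n)) → Fin (suc (suc n)) → Carrier
    minor v j = det R (suc n) (dropColumn j (v ∷ Rs))

    minor-linear : ∀ j → minor y j ≈ α * minor y₁ j + β * minor y₂ j
    minor-linear j = begin
      minor y j
        ≈⟨ det-dropColumn-∷ j y Rs ⟩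
      det R (suc n) ((y ∘ punchIn j) ∷ dropColumn j Rs)
        ≈⟨ det-linear₀ α β (dropColumn j Rs) (y≈ ∘ punchIn j) ⟩
      α * det R (suc n) ((y₁ ∘ punchIn j) ∷ dropColumn j Rs)
        + β * det R (suc n) ((y₂ ∘ punchIn j) ∷ dropColumn j Rs)
        ≈⟨ +-cong (*-congˡ (det-dropColumn-∷ j y₁ Rs)) (*-congˡ (det-dropColumn-∷ j y₂ Rs)) ⟨
      α * minor y₁ j + β * minor y₂ j ∎

  -- A determinant whose first two rows both equal u, expanded along those two
  -- rows, is the double sum below; Φ σ is the complementary minor on the
  -- columns σ that survive.
  doubleExpansion : ∀ n → Row (suc (suc n)) → ((Fin n → Fin (suc (suc n))) → Carrier) → Carrier
  doubleExpansion n u Φ =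
    ∑ λ j → sgn j * (u j * ∑ λ k → sgn k * (u (punchIn j k) * Φ (punchIn j ∘ punchIn k)))

  -- the part of doubleExpansion where neither deleted column is column 0
  innerExpansion : ∀ n → Row (suc (suc n)) → ((Fin n → Fin (suc (suc n))) → Carrier) → Carrier
  innerExpansion n u Φ =
    ∑ λ j → sgn j * (u (suc j) * ∑ λ k →
      sgn k * (u (suc (punchIn j k)) * Φ (punchIn (suc j) ∘ punchIn (suc k))))

  Extensional : ∀ {a b} → ((Fin a → Fin b) → Carrier) → Set ℓ
  Extensional Φ = ∀ {σ τ} → (∀ l → σ l ≡ τ l) → Φ σ ≈ Φ τ

  -- Pairs in which column 0 is deleted first cancel against pairs in which
  -- it is deleted second, since the two orders carry opposite signs.
  doubleExpansion-peel : ∀ n u Φ → doubleExpansion n u Φ ≈ innerExpansion n u Φ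
  doubleExpansion-peel n u Φ = begin
    1# * (u₀ * ∑ a) + ∑ T                       ≈⟨ +-congˡ (∑-linear (- u₀) 1# T≈) ⟩
    1# * (u₀ * ∑ a) + (- u₀ * ∑ a + 1# * ∑ W)
      ≈⟨ solve 3 (λ u₀ A B → 𝟙 :* (u₀ :* A) :+ (:- u₀ :* A :+ 𝟙 :* B) := B) refl u₀ (∑ a) (∑ W) ⟩
    ∑ W                                          ∎
    where
    u₀ = u zero
    -- column 0 deleted first, then column suc k
    a : Row (suc n)
    a k = sgn k * (u (suc k) * Φ (suc ∘ punchIn k))
    B : Row (suc n)
    B j = ∑ λ k → sgn k * (u (suc (punchIn j k)) * Φ (punchIn (suc j) ∘ punchIn (suc k)))
    W : Row (suc n)
    W j = sgn j * (u (suc j) * B j)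
    inner : Row (suc n)
    inner j = ∑ λ k → sgn k * (u (punchIn (suc j) k) * Φ (punchIn (suc j) ∘ punchIn k))
    T : Row (suc n)
    T j = sgn (suc j) * (u (suc j) * inner j)

    -- column suc j deleted first: column 0 comes second (with sign +), or not at all
    inner≈ : ∀ j → inner j ≈ u₀ * Φ (suc ∘ punchIn j) + - 1# * B j
    inner≈ j = begin
      1# * (u₀ * φ) + ∑ (λ k → - sgn k * X k)   ≈⟨ +-cong (*-identityˡ _) (∑-linear (- 1#) 0# X≈) ⟩
      u₀ * φ + (- 1# * B j + 0# * B j)
        ≈⟨ solve 3 (λ A B' C → A :+ (:- 𝟙 :* B' :+ 𝟘 :* C) := A :+ :- 𝟙 :* B') refl _ (B j) (B j) ⟩
      u₀ * φ + - 1# * B j                       ∎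
      where
      φ = Φ (suc ∘ punchIn j)
      X : Fin n → Carrier
      X k = u (suc (punchIn j k)) * Φ (punchIn (suc j) ∘ punchIn (suc k))
      X≈ : ∀ k → - sgn k * X k ≈ - 1# * (sgn k * X k) + 0# * (sgn k * X k)
      X≈ k = solve 2 (λ s x → :- s :* x := :- 𝟙 :* (s :* x) :+ 𝟘 :* (s :* x)) refl (sgn k) (X k)

    T≈ : ∀ j → T j ≈ - u₀ * a j + 1# * W j
    T≈ j = trans (*-congˡ (*-congˡ (inner≈ j)))
      (solve 5 (λ s v u₀ φ b → :- s :* (v :* (u₀ :* φ :+ :- 𝟙 :* b))
                              := :- u₀ :* (s :* (v :* φ)) :+ 𝟙 :* (s :* (v :* b)))
             refl (sgn j) (u (suc j)) u₀ (Φ (suc ∘ punchIn j)) (B j))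

  -- with only two columns, no pair avoids column 0
  innerExpansion-zero : ∀ u Φ → innerExpansion zero u Φ ≈ 0#
  innerExpansion-zero u Φ = ∑-zero λ j →
    solve 2 (λ s v → s :* (v :* 𝟘) := 𝟘) refl (sgn j) (u (suc j))

  innerExpansion-suc : ∀ n u Φ → Extensional Φ →
    innerExpansion (suc n) u Φ ≈ doubleExpansion n (u ∘ suc) (Φ ∘ Fin.lift 1)
  innerExpansion-suc n u Φ Φ-ext =
    ∑-cong {f = outer inner₁} {g = outer inner₂} λ j → *-congˡ (*-congˡ
      (∑-cong {f = inner₁ j} {g = inner₂ j} λ k → *-congˡ (*-congˡ
        (Φ-ext λ { zero → ≡.refl ; (suc l) → ≡.refl }))))
    where
    inner₁ inner₂ : Fin (suc (suc n)) → Fin (suc n) → Carrier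
    inner₁ j k = sgn k * (u (suc (punchIn j k)) * Φ (punchIn (suc j) ∘ punchIn (suc k)))
    inner₂ j k = sgn k * (u (suc (punchIn j k)) * Φ (Fin.lift 1 (punchIn j ∘ punchIn k)))
    outer : (Fin (suc (suc n)) → Fin (suc n) → Carrier) → Row (suc (suc n))
    outer inner j = sgn j * (u (suc j) * ∑ (inner j))

  doubleExpansion-vanishes : ∀ n u Φ → Extensional Φ → doubleExpansion n u Φ ≈ 0#
  doubleExpansion-vanishes zero u Φ Φ-ext =
    trans (doubleExpansion-peel zero u Φ) (innerExpansion-zero u Φ)
  doubleExpansion-vanishes (suc n) u Φ Φ-ext = begin
    doubleExpansion (suc n) u Φ               ≈⟨ doubleExpansion-peel (suc n) u Φ ⟩
    innerExpansion (suc n) u Φ                ≈⟨ innerExpansion-suc n u Φ Φ-ext ⟩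
    doubleExpansion n (u ∘ suc) (Φ ∘ Fin.lift 1)
      ≈⟨ doubleExpansion-vanishes n (u ∘ suc) (Φ ∘ Fin.lift 1) (Φ-ext ∘ lift-cong) ⟩
    0#                                        ∎
    where
    lift-cong : ∀ {σ τ : Fin n → Fin (suc (suc n))} → (∀ l → σ l ≡ τ l) →
                ∀ l → Fin.lift 1 σ l ≡ Fin.lift 1 τ l
    lift-cong σ≡τ zero    = ≡.refl
    lift-cong σ≡τ (suc l) = ≡.cong suc (σ≡τ l)

  det-alternating : ∀ {n} (x : Row (suc (suc n))) (Rs : Rows n (suc (suc n))) →
                    det R (suc (suc n)) (x ∷ x ∷ Rs) ≈ 0#
  det-alternating {n} x Rs = doubleExpansion-vanishes n x (λ σ → det R n (λ i l → Rs i (σ l)))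
    λ {σ} {τ} σ≡τ → det-cong n _ _ λ i l → reflexive (≡.cong (Rs i) (σ≡τ l))

  det-swap : ∀ {n} (x y : Row (suc (suc n))) (Rs : Rows n (suc (suc n))) →
             det R (suc (suc n)) (y ∷ x ∷ Rs) ≈ - det R (suc (suc n)) (x ∷ y ∷ Rs)
  det-swap {n} x y Rs = +-inverseʳ-unique (D x y) (D y x) (begin
    D x y + D y x
      ≈⟨ solve 2 (λ a b → a :+ b := 𝟙 :* (𝟙 :* 𝟘 :+ 𝟙 :* a) :+ 𝟙 :* (𝟙 :* b :+ 𝟙 :* 𝟘))
               refl (D x y) (D y x) ⟩
    1# * (1# * 0# + 1# * D x y) + 1# * (1# * D y x + 1# * 0#)
      ≈⟨ +-cong (*-congˡ (+-congʳ (*-congˡ (det-alternating x Rs))))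
                (*-congˡ (+-congˡ (*-congˡ (det-alternating y Rs)))) ⟨
    1# * (1# * D x x + 1# * D x y) + 1# * (1# * D y x + 1# * D y y)
      ≈⟨ +-cong (*-congˡ (det-linear₁ 1# 1# x Rs s≈)) (*-congˡ (det-linear₁ 1# 1# y Rs s≈)) ⟨
    1# * D x s + 1# * D y s
      ≈⟨ det-linear₀ 1# 1# (s ∷ Rs) s≈ ⟨
    D s s
      ≈⟨ det-alternating s Rs ⟩
    0# ∎)
    where
    D : Row (suc (suc n)) → Row (suc (suc n)) → Carrier
    D v w = det R (suc (suc n)) (v ∷ w ∷ Rs)
    s : Row (suc (suc n))
    s j = x j + y j
    s≈ : ∀ j → s j ≈ 1# * x j + 1# * y j
    s≈ j = +-cong (sym (*-identityˡ (x j))) (sym (*-identityˡ (y j)))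

  det-addRow : ∀ {n} t {x w : Row (suc (suc n))} (y : Row (suc (suc n))) (Rs : Rows n (suc (suc n))) →
               (∀ j → x j ≈ w j + t * y j) →
               det R (suc (suc n)) (x ∷ y ∷ Rs) ≈ det R (suc (suc n)) (w ∷ y ∷ Rs)
  det-addRow {n} t {x} {w} y Rs x≈ = begin
    det R (suc (suc n)) (x ∷ y ∷ Rs)
      ≈⟨ det-linear₀ 1# t (y ∷ Rs) (λ j → trans (x≈ j) (+-congʳ (sym (*-identityˡ (w j))))) ⟩
    1# * det R (suc (suc n)) (w ∷ y ∷ Rs) + t * det R (suc (suc n)) (y ∷ y ∷ Rs)
      ≈⟨ +-congˡ (*-congˡ (det-alternating y Rs)) ⟩
    1# * det R (suc (suc n)) (w ∷ y ∷ Rs) + t * 0#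
      ≈⟨ solve 2 (λ a t → 𝟙 :* a :+ t :* 𝟘 := a) refl _ t ⟩
    det R (suc (suc n)) (w ∷ y ∷ Rs) ∎

  det-expand₁ : ∀ {n} (x : Row (suc n)) (Rs : Rows n (suc n)) → (∀ j → x (suc j) ≈ 0#) →
                det R (suc n) (x ∷ Rs) ≈ x zero * det R n (dropColumn zero Rs)
  det-expand₁ {n} x Rs x≈0 = begin
    1# * (x zero * A) + ∑ (λ j → sgn (suc j) * (x (suc j) * det R n (dropColumn (suc j) Rs)))
      ≈⟨ +-congˡ (∑-zero λ j → trans (*-congˡ (*-congʳ (x≈0 j)))
                                    (solve 2 (λ s m → s :* (𝟘 :* m) := 𝟘) refl (sgn (suc j)) _)) ⟩
    1# * (x zero * A) + 0#
      ≈⟨ solve 1 (λ a → 𝟙 :* a :+ 𝟘 := a) refl _ ⟩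
    x zero * A ∎
    where A = det R n (dropColumn zero Rs)

  det-expand₂ : ∀ {n} (x : Row (suc (suc n))) (Rs : Rows (suc n) (suc (suc n))) →
                (∀ j → x (suc (suc j)) ≈ 0#) →
                det R (suc (suc n)) (x ∷ Rs) ≈
                x zero * det R (suc n) (dropColumn zero Rs) - x (suc zero) * det R (suc n) (dropColumn (suc zero) Rs)
  det-expand₂ {n} x Rs x≈0 = begin
    1# * (x zero * A) + (- 1# * (x (suc zero) * B) + ∑ rest)
      ≈⟨ +-congˡ (+-congˡ (∑-zero λ j → trans (*-congˡ (*-congʳ (x≈0 j)))
                              (solve 2 (λ s m → s :* (𝟘 :* m) := 𝟘) refl (sgn (suc (suc j))) _))) ⟩
    1# * (x zero * A) + (- 1# * (x (suc zero) * B) + 0#)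
      ≈⟨ solve 4 (λ a b A B → 𝟙 :* (a :* A) :+ (:- 𝟙 :* (b :* B) :+ 𝟘) := a :* A :- b :* B)
               refl (x zero) (x (suc zero)) A B ⟩
    x zero * A - x (suc zero) * B ∎
    where
    A = det R (suc n) (dropColumn zero Rs)
    B = det R (suc n) (dropColumn (suc zero) Rs)
    rest : Fin n → Carrier
    rest j = sgn (suc (suc j)) * (x (suc (suc j)) * det R (suc n) (dropColumn (suc (suc j)) Rs))

module ThresholdDeterminant {c ℓ : Level} (R : CommutativeRing c ℓ) where
  open CommutativeRing R hiding (zero)
  open IntegerSolver R
  open DeterminantAlgebra R
  open import Data.Fin.Properties using (<-cmp; toℕ-fromℕ<)
  open import Relation.Binary.Definitions using (tri<; tri≈; tri>)
  open import Relation.Binary.Reasoning.Setoid setoid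

  thresholdRec : ∀ m → (Fin m → Carrier) → (Fin (suc m) → Carrier) → Rows (suc m) (suc m)
  thresholdRec zero    b d = (d zero ∷ λ ()) ∷ λ ()
  thresholdRec (suc m) b d =
    (head d ∷ λ _ → head b) ∷ λ i → head b ∷ thresholdRec m (tail b) (tail d) i

  thresholdRec-diagonal : ∀ m b d i → thresholdRec m b d i i ≡ d i
  thresholdRec-diagonal zero    b d zero    = ≡.refl
  thresholdRec-diagonal (suc m) b d zero    = ≡.refl
  thresholdRec-diagonal (suc m) b d (suc i) = thresholdRec-diagonal m (tail b) (tail d) i

  thresholdRec-symmetric : ∀ m b d i j → thresholdRec m b d i j ≡ thresholdRec m b d j i
  thresholdRec-symmetric zero    b d zero    zero    = ≡.refl
  thresholdRec-symmetric (suc m) b d zero    zero    = ≡.refl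
  thresholdRec-symmetric (suc m) b d zero    (suc j) = ≡.refl
  thresholdRec-symmetric (suc m) b d (suc i) zero    = ≡.refl
  thresholdRec-symmetric (suc m) b d (suc i) (suc j) =
    thresholdRec-symmetric m (tail b) (tail d) i j

  thresholdRec-above : ∀ m b d {i j : Fin (suc m)} (k : Fin m) → toℕ k ≡ toℕ i → i Fin.< j →
                       thresholdRec m b d i j ≡ b k
  thresholdRec-above (suc m) b d {zero}  {suc j} zero    k≡i i<j = ≡.refl
  thresholdRec-above (suc m) b d {suc i} {suc j} (suc k) k≡i i<j =
    thresholdRec-above m (tail b) (tail d) k (ℕₚ.suc-injective k≡i) (ℕ.s<s⁻¹ i<j)
  thresholdRec-above (suc m) b d {zero}  {zero}  zero    k≡i ()
  thresholdRec-above (suc m) b d {suc i} {zero}  k       k≡i ()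

  thresholdRec-agrees : ∀ m b d i j → threshold R m b d i j ≡ thresholdRec m b d i j
  thresholdRec-agrees m b d i j with <-cmp i j
  ... | tri< i<j _ _ = ≡.sym (thresholdRec-above m b d _ (toℕ-fromℕ< _) i<j)
  ... | tri≈ _ ≡.refl _ = ≡.sym (thresholdRec-diagonal m b d i)
  ... | tri> _ _ j<i = ≡.sym (≡.trans (thresholdRec-symmetric m b d i j)
                                     (thresholdRec-above m b d _ (toℕ-fromℕ< _) j<i))

  ones : ∀ {n} → Row n
  ones _ = 1#

  border : ∀ {n} → Carrier → Rows n n → Rows (suc n) (suc n)
  border γ T = ones ∷ λ i → γ ∷ T i

  detT : ∀ m → (Fin m → Carrier) → (Fin (suc m) → Carrier) → Carrier
  detT m b d = det R (suc m) (thresholdRec m b d)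

  detQ : ∀ m → Carrier → (Fin m → Carrier) → (Fin (suc m) → Carrier) → Carrier
  detQ m γ b d = det R (suc (suc m)) (border γ (thresholdRec m b d))

  detT-base : ∀ b d → detT zero b d ≈ d zero
  detT-base b d = solve 1 (λ x → 𝟙 :* (x :* 𝟙) :+ 𝟘 := x) refl (d zero)

  detQ-base : ∀ γ b d → detQ zero γ b d ≈ d zero - γ
  detQ-base γ b d =
    solve 2 (λ x γ → 𝟙 :* (𝟙 :* (𝟙 :* (x :* 𝟙) :+ 𝟘))
                     :+ (:- 𝟙 :* (𝟙 :* (𝟙 :* (γ :* 𝟙) :+ 𝟘)) :+ 𝟘) := x :- γ)
          refl (d zero) γ

  -- first row (d₀, b₀, …, b₀) = (d₀ - b₀) e₀ + b₀ 1: linearity and expansion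
  detT-step : ∀ m b d →
    detT (suc m) b d ≈ (head d - head b) * detT m (tail b) (tail d) + head b * detQ m (head b) (tail b) (tail d)
  detT-step m b d = begin
    det R (suc (suc m)) ((head d ∷ λ _ → head b) ∷ Rs)
      ≈⟨ det-linear₀ 1# (head b) Rs first≈ ⟩
    1# * det R (suc (suc m)) (e ∷ Rs) + head b * det R (suc (suc m)) (ones ∷ Rs)
      ≈⟨ +-congʳ (*-congˡ (det-expand₁ e Rs λ _ → refl)) ⟩
    1# * ((head d - head b) * detT m (tail b) (tail d)) + head b * detQ m (head b) (tail b) (tail d)
      ≈⟨ +-congʳ (*-identityˡ _) ⟩
    (head d - head b) * detT m (tail b) (tail d) + head b * detQ m (head b) (tail b) (tail d) ∎
    where
    Rs : Rows (suc m) (suc (suc m))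
    Rs i = head b ∷ thresholdRec m (tail b) (tail d) i
    e : Row (suc (suc m))
    e = (head d - head b) ∷ λ _ → 0#
    first≈ : ∀ j → (head d ∷ λ _ → head b) j ≈ 1# * e j + head b * ones j
    first≈ zero    = solve 2 (λ x y → x := 𝟙 :* (x :- y) :+ y :* 𝟙) refl (head d) (head b)
    first≈ (suc j) = solve 1 (λ y → y := 𝟙 :* 𝟘 :+ y :* 𝟙) refl (head b)

  -- swap the first two rows, subtract b₀ 1 from the new first row, which
  -- leaves (γ - b₀, d₀ - b₀, 0, …, 0), and expand along it
  detQ-step : ∀ m γ b d →
    detQ (suc m) γ b d ≈ - ((γ - head b) * detQ m (head b) (tail b) (tail d)
                            - (head d - head b) * detQ m γ (tail b) (tail d))
  detQ-step m γ b d = begin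
    detQ (suc m) γ b d
      ≈⟨ det-cong (suc (suc (suc m))) (border γ (thresholdRec (suc m) b d)) (ones ∷ r ∷ Rs)
                  (λ { zero k → refl ; (suc zero) k → refl ; (suc (suc i)) k → refl }) ⟩
    det R (suc (suc (suc m))) (ones ∷ r ∷ Rs)
      ≈⟨ det-swap r ones Rs ⟩
    - det R (suc (suc (suc m))) (r ∷ ones ∷ Rs)
      ≈⟨ -‿cong (det-addRow (head b) ones Rs r≈) ⟩
    - det R (suc (suc (suc m))) (w ∷ ones ∷ Rs)
      ≈⟨ -‿cong (det-expand₂ w (ones ∷ Rs) λ _ → refl) ⟩
    - ((γ - head b) * det R (suc (suc m)) (dropColumn zero (ones ∷ Rs))
       - (head d - head b) * det R (suc (suc m)) (dropColumn (suc zero) (ones ∷ Rs)))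
      ≈⟨ -‿cong (+-cong (*-congˡ (det-cong (suc (suc m)) (dropColumn zero (ones ∷ Rs)) (border (head b) T)
                                   λ { zero k → refl ; (suc i) zero → refl ; (suc i) (suc k) → refl }))
                        (-‿cong (*-congˡ (det-cong (suc (suc m)) (dropColumn (suc zero) (ones ∷ Rs)) (border γ T)
                                   λ { zero k → refl ; (suc i) zero → refl ; (suc i) (suc k) → refl })))) ⟩
    - ((γ - head b) * detQ m (head b) (tail b) (tail d)
       - (head d - head b) * detQ m γ (tail b) (tail d)) ∎
    where
    T = thresholdRec m (tail b) (tail d)
    r : Row (suc (suc (suc m)))
    r = γ ∷ (head d ∷ λ _ → head b)
    Rs : Rows (suc m) (suc (suc (suc m)))
    Rs i = γ ∷ head b ∷ T i
    w : Row (suc (suc (suc m)))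
    w = (γ - head b) ∷ (head d - head b) ∷ λ _ → 0#
    r≈ : ∀ j → r j ≈ w j + head b * ones j
    r≈ zero          = solve 2 (λ x y → x := (x :- y) :+ y :* 𝟙) refl γ (head b)
    r≈ (suc zero)    = solve 2 (λ x y → x := (x :- y) :+ y :* 𝟙) refl (head d) (head b)
    r≈ (suc (suc j)) = solve 1 (λ y → y := 𝟘 :+ y :* 𝟙) refl (head b)

  -- det T together with the coefficients of Q(γ) = p - γ * r
  record Summary : Set c where
    constructor ⟨_,_,_⟩
    field
      dT p r : Carrier
  open Summary public

  -- the recurrences of detT-step and detQ-step in terms of summaries
  extend : Carrier → Carrier → Summary → Summary
  extend β δ s = ⟨ ε * dT s + β * q , β * q + ε * p s , ε * r s + q ⟩
    where
    ε = δ - β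
    q = p s - β * r s    -- Q(β)

  summarize : ∀ m → (Fin m → Carrier) → (Fin (suc m) → Carrier) → Summary
  summarize zero    b d = ⟨ d zero , d zero , 1# ⟩
  summarize (suc m) b d = extend (head b) (head d) (summarize m (tail b) (tail d))

  summarize-correct : ∀ m b d →
    detT m b d ≈ dT (summarize m b d) × (∀ γ → detQ m γ b d ≈ p (summarize m b d) - γ * r (summarize m b d))
  summarize-correct zero b d =
    detT-base b d , λ γ → trans (detQ-base γ b d) (solve 2 (λ x γ → x :- γ := x :- γ :* 𝟙) refl (d zero) γ)
  summarize-correct (suc m) b d = detT≈ , detQ≈
    where
    s = summarize m (tail b) (tail d)
    β = head b
    δ = head d
    ih = summarize-correct m (tail b) (tail d)
    Q≈ : ∀ γ → detQ m γ (tail b) (tail d) ≈ p s - γ * r s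
    Q≈ = proj₂ ih

    detT≈ : detT (suc m) b d ≈ dT (extend β δ s)
    detT≈ = trans (detT-step m b d) (+-cong (*-congˡ (proj₁ ih)) (*-congˡ (Q≈ β)))

    detQ≈ : ∀ γ → detQ (suc m) γ b d ≈ p (extend β δ s) - γ * r (extend β δ s)
    detQ≈ γ = begin
      detQ (suc m) γ b d
        ≈⟨ detQ-step m γ b d ⟩
      - ((γ - β) * detQ m β (tail b) (tail d) - (δ - β) * detQ m γ (tail b) (tail d))
        ≈⟨ -‿cong (+-cong (*-congˡ (Q≈ β)) (-‿cong (*-congˡ (Q≈ γ)))) ⟩
      - ((γ - β) * (p s - β * r s) - (δ - β) * (p s - γ * r s))
        ≈⟨ solve 5 (λ γ β δ P Rr → :- ((γ :- β) :* (P :- β :* Rr) :- (δ :- β) :* (P :- γ :* Rr))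
                     := (β :* (P :- β :* Rr) :+ (δ :- β) :* P) :- γ :* ((δ :- β) :* Rr :+ (P :- β :* Rr)))
                 refl γ β δ (p s) (r s) ⟩
      p (extend β δ s) - γ * r (extend β δ s) ∎

  det-threshold : ∀ m b d → det R (suc m) (threshold R m b d) ≈ dT (summarize m b d)
  det-threshold m b d = trans
    (det-cong (suc m) (threshold R m b d) (thresholdRec m b d) λ i j → reflexive (thresholdRec-agrees m b d i j))
    (proj₁ (summarize-correct m b d))

-- natural-number arithmetic for program sizes; imported only here, since the
-- ring modules above use _+_ and _*_ for the ring operations
open import Data.Nat using (_+_; _*_; _≤_)

-- A program that still has to consume a summary: given a renaming of the
-- current registers into the final register file and the registers holding
-- dT, p and r, it produces the rest of the program.
Continuation : ℕ → Set
Continuation k = ∀ {k'} → (Fin k → Fin k') → Fin k' → Fin k' → Fin k' → SLP k'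

extendCode : ∀ {k} (β δ D P Rr : Fin k) → Continuation k → SLP k
extendCode β δ D P Rr K =
  mul β Rr ▹                  -- β r
  (sub (1 ↑ʳ P) (# 0) ▹       -- q = p - β r
  (sub (2 ↑ʳ δ) (2 ↑ʳ β) ▹    -- ε = δ - β
  (mul (# 0) (3 ↑ʳ D) ▹       -- ε dT
  (mul (4 ↑ʳ β) (# 2) ▹       -- β q
  (add (# 1) (# 0) ▹          -- ε dT + β q
  (mul (# 3) (6 ↑ʳ P) ▹       -- ε p
  (add (# 2) (# 0) ▹          -- β q + ε p
  (mul (# 5) (8 ↑ʳ Rr) ▹      -- ε r
  (add (# 0) (# 7) ▹          -- ε r + q
  K (10 ↑ʳ_) (# 4) (# 2) (# 0))))))))))

summaryProgram : ∀ m {k} → (Fin m → Fin k) → (Fin (suc m) → Fin k) → Fin k → Continuation k → SLP k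
summaryProgram zero    bs ds one K = K id (head ds) (head ds) one
summaryProgram (suc m) bs ds one K =
  summaryProgram m (tail bs) (tail ds) one λ w D P Rr →
    extendCode (w (head bs)) (w (head ds)) D P Rr λ w′ → K (w′ ∘ w)

-- The input registers are 1, b, d (see `inputs`); the output is dT.
theProgram : ∀ m → SLP (InputRegs m)
theProgram m = summaryProgram m (λ i → suc (i ↑ˡ suc m)) (λ i → suc (m ↑ʳ i)) zero
                 λ _ D _ _ → ret D

summaryProgram-size : ∀ m {k} bs ds one (K : Continuation k) s →
  (∀ {k'} w D P Rr → size (K {k'} w D P Rr) ≡ s) → size (summaryProgram m bs ds one K) ≡ m * 10 + s
summaryProgram-size zero    bs ds one K s size-K = size-K id _ _ _
summaryProgram-size (suc m) bs ds one K s size-K = ≡.trans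
  (summaryProgram-size m (tail bs) (tail ds) one _ (10 + s) λ _ _ _ _ → ≡.cong (10 +_) (size-K _ _ _ _))
  (≡.trans (≡.sym (ℕₚ.+-assoc (m * 10) 10 s)) (≡.cong (_+ s) (ℕₚ.+-comm (m * 10) 10)))

theProgram-size : ∀ m → size (theProgram m) ≤ 10 * suc m
theProgram-size m = begin
  size (theProgram m)   ≡⟨ summaryProgram-size m _ _ zero _ 0 (λ _ _ _ _ → ≡.refl) ⟩
  m * 10 + 0            ≡⟨ ℕₚ.+-identityʳ (m * 10) ⟩
  m * 10                ≤⟨ ℕₚ.m≤n+m (m * 10) 10 ⟩
  suc m * 10            ≡⟨ ℕₚ.*-comm (suc m) 10 ⟩
  10 * suc m            ∎
  where open ℕₚ.≤-Reasoning

module ProgramCorrectness {c ℓ : Level} (R : CommutativeRing c ℓ) where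
  open CommutativeRing R hiding (zero)
  open ThresholdDeterminant R using (Summary; dT; p; r; extend; summarize; det-threshold)

  Finishes : ∀ {k} → Continuation k → Vector Carrier k → Summary → Carrier → Set (c ⊔ ℓ)
  Finishes {k} K env s t = ∀ {k'} (w : Fin k → Fin k') (D P Rr : Fin k') (env' : Vector Carrier k') →
    (∀ i → env' (w i) ≡ env i) → env' D ≈ dT s → env' P ≈ p s → env' Rr ≈ r s →
    eval R (K w D P Rr) env' ≈ t

  extendCode-correct : ∀ {k} (β δ D P Rr : Fin k) (K : Continuation k) env {b d} s t →
    env β ≈ b → env δ ≈ d → env D ≈ dT s → env P ≈ p s → env Rr ≈ r s →
    Finishes K env (extend b d s) t → eval R (extendCode β δ D P Rr K) env ≈ t
  extendCode-correct β δ D P Rr K env s t β≈ δ≈ D≈ P≈ R≈ K-finishes =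
    K-finishes (10 ↑ʳ_) (# 4) (# 2) (# 0) _ (λ _ → ≡.refl)
      (+-cong (*-cong ε≈ D≈) (*-cong β≈ q≈))
      (+-cong (*-cong β≈ q≈) (*-cong ε≈ P≈))
      (+-cong (*-cong ε≈ R≈) q≈)
    where
    ε≈ = +-cong δ≈ (-‿cong β≈)
    q≈ = +-cong P≈ (-‿cong (*-cong β≈ R≈))

  summaryProgram-correct : ∀ m {k} bs ds one (K : Continuation k) env b d t →
    env one ≈ 1# → (∀ i → env (bs i) ≈ b i) → (∀ i → env (ds i) ≈ d i) →
    Finishes K env (summarize m b d) t → eval R (summaryProgram m bs ds one K) env ≈ t
  summaryProgram-correct zero bs ds one K env b d t one≈ bs≈ ds≈ K-finishes =
    K-finishes id (head ds) (head ds) one env (λ _ → ≡.refl) (ds≈ zero) (ds≈ zero) one≈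
  summaryProgram-correct (suc m) bs ds one K env b d t one≈ bs≈ ds≈ K-finishes =
    summaryProgram-correct m (tail bs) (tail ds) one _ env (tail b) (tail d) t one≈ (bs≈ ∘ suc) (ds≈ ∘ suc)
      λ w D P Rr env' w≈ D≈ P≈ R≈ →
        extendCode-correct (w (head bs)) (w (head ds)) D P Rr (λ w′ → K (w′ ∘ w)) env' _ t
          (trans (reflexive (w≈ (head bs))) (bs≈ zero)) (trans (reflexive (w≈ (head ds))) (ds≈ zero))
          D≈ P≈ R≈
          λ w′ D′ P′ R′ env″ w′≈ → K-finishes (w′ ∘ w) D′ P′ R′ env″ (λ i → ≡.trans (w′≈ (w i)) (w≈ i))

  theProgram-correct : ∀ m b d → eval R (theProgram m) (inputs R m b d) ≈ det R (suc m) (threshold R m b d)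
  theProgram-correct m b d =
    summaryProgram-correct m _ _ zero _ (inputs R m b d) b d _ refl
      (λ i → reflexive (lookup-++ˡ b d i)) (λ i → reflexive (lookup-++ʳ b d i))
      λ _ _ _ _ _ _ D≈ _ _ → trans D≈ (sym (det-threshold m b d))

corollary1 : (c ℓ : Level) →
    Σ ℕ λ C → (m : ℕ) → Σ (SLP (InputRegs m)) λ P →
      (size P ≤ C * suc m) ×
      ((R : CommutativeRing c ℓ) →
        (b : Fin m → CommutativeRing.Carrier R) →
        (d : Fin (suc m) → CommutativeRing.Carrier R) →
        CommutativeRing._≈_ R (eval R P (inputs R m b d))
                              (det R (suc m) (threshold R m b d)))
corollary1 c ℓ = 10 , λ m → theProgram m , theProgram-size m ,
  λ R → ProgramCorrectness.theProgram-correct R m
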